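{- Let $G=(V,E)$ be a finite, connected, undirected graph (multiple edges allowed, no loops), and let $\{A,B\}$ be a cut of $G$. Let $D$ be a boundary divisor of this cut, i.e. for some $X\in\{A,B\}$, $D_v=\deg_{AB}(v)\chi_X(v)$ for all $v\in V$. Then there is no effective divisor $D_0\sim D$ whose support intersects both $A$ and $B$.
   Context: A cut of $G$ is an unordered partition $\{A,B\}$ of $V$ into two nonempty sets each inducing a connected subgraph. For $A,B\subseteq V$ and $v\in V$, $\deg_{AB}(v)$ is the number of edges incident to $v$ having one endpoint in $A$ and the other in $B$; $\chi_X$ is the indicator function of $X$. The Laplacian $L$ has $L_{vv}=\deg(v)$ and $L_{uv}=-(\text{number of edges between }u,v)$ for $u\ne v$; divisors are elements of $\mathbb{Z}^V$, $D\sim D'$ iff $D-D'\in L(\mathbb{Z}^V)$; effective means all entries $\ge0$; $\operatorname{supp}(D)=\{v:D_v\ne0\}$. -}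

module Defs where

open import Data.Nat using (ℕ; zero; suc; _<_)
open import Data.Bool using (Bool; true; false; not; _∧_; _∨_; if_then_else_)
open import Data.Fin using (Fin; zero; suc; _≟_)
open import Data.Integer using (ℤ; +_; -_; _-_; _≤_)
import Data.Integer as ℤ
import Data.Nat as ℕ
open import Data.Product using (Σ; _×_; ∃; ∃-syntax; _,_)
open import Relation.Binary.PropositionalEquality using (_≡_; _≢_)
open import Relation.Nullary.Decidable using (⌊_⌋)

sumℕ : ∀ {n} → (Fin n → ℕ) → ℕ
sumℕ {zero} f = 0
sumℕ {suc n} f = f zero ℕ.+ sumℕ (λ i → f (suc i))

sumℤ : ∀ {n} → (Fin n → ℤ) → ℤ
sumℤ {zero} f = + 0
sumℤ {suc n} f = f zero ℤ.+ sumℤ (λ i → f (suc i))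

record Multigraph (n : ℕ) : Set where
  field
    mult      : Fin n → Fin n → ℕ
    symmetric : ∀ u v → mult u v ≡ mult v u
    loopless  : ∀ v → mult v v ≡ 0
open Multigraph public

Subset : ℕ → Set
Subset n = Fin n → Bool

compl : ∀ {n} → Subset n → Subset n
compl S v = not (S v)

full : ∀ {n} → Subset n
full _ = true

data Reach {n} (G : Multigraph n) (S : Subset n) : Fin n → Fin n → Set where
  here : ∀ {v} → S v ≡ true → Reach G S v v
  step : ∀ {u w v} → S u ≡ true → 0 < mult G u w → Reach G S w v → Reach G S u v

InducesConnected : ∀ {n} → Multigraph n → Subset n → Set
InducesConnected G S = ∀ u v → S u ≡ true → S v ≡ true → Reach G S u v

Connected : ∀ {n} → Multigraph n → Set
Connected G = InducesConnected G full

NonEmpty : ∀ {n} → Subset n → Set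
NonEmpty S = ∃[ v ] S v ≡ true

IsCut : ∀ {n} → Multigraph n → Subset n → Set
IsCut G A = NonEmpty A × NonEmpty (compl A)
          × InducesConnected G A × InducesConnected G (compl A)

crosses : ∀ {n} → Subset n → Fin n → Fin n → Bool
crosses A u v = (A u ∧ not (A v)) ∨ (not (A u) ∧ A v)

degAB : ∀ {n} → Multigraph n → Subset n → Fin n → ℕ
degAB G A v = sumℕ (λ u → if crosses A v u then mult G v u else 0)

χ : ∀ {n} → Subset n → Fin n → ℕ
χ X v = if X v then 1 else 0

Divisor : ℕ → Set
Divisor n = Fin n → ℤ

deg : ∀ {n} → Multigraph n → Fin n → ℕ
deg G v = sumℕ (mult G v)

Laplacian : ∀ {n} → Multigraph n → Fin n → Fin n → ℤ
Laplacian G u v = if ⌊ u ≟ v ⌋ then + deg G u else - (+ mult G u v)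

applyL : ∀ {n} → Multigraph n → (Fin n → ℤ) → Divisor n
applyL G z u = sumℤ (λ v → Laplacian G u v ℤ.* z v)

LinEquiv : ∀ {n} → Multigraph n → Divisor n → Divisor n → Set
LinEquiv G D D' = ∃[ z ] (∀ v → D v - D' v ≡ applyL G z v)

Effective : ∀ {n} → Divisor n → Set
Effective D = ∀ v → + 0 ≤ D v

SuppMeets : ∀ {n} → Divisor n → Subset n → Set
SuppMeets D S = ∃[ v ] (S v ≡ true × D v ≢ + 0)

IsBoundaryDivisor : ∀ {n} → Multigraph n → Subset n → Subset n → Divisor n → Set
IsBoundaryDivisor G A X D = ∀ v → D v ≡ + (degAB G A v ℕ.* χ X v)

module Submission where

-- Write X for the side carrying the boundary divisor D.  If D₀ = D + L z is
-- effective, then edge by edge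
--     D₀(v) = Σ_u mult(v,u) · (β(v,u) + z(v) − z(u)),
-- where β(v,u) = 1 if the edge vu leaves X (v ∈ X, u ∉ X) and 0 otherwise.
-- Let m be the minimum of z and call v flat when z(v) = m.  At a flat vertex
-- every summand is ≤ 0 except possibly along edges leaving X towards flat
-- vertices; when none of those exist, effectivity forces D₀(v) = 0 and makes
-- flatness spread to all neighbours reached without leaving X.  Since each
-- side induces a connected subgraph and meets supp D₀, flatness cannot reach
-- the support vertex of that side: first no vertex outside X is flat, hence no
-- vertex of X is flat either, contradicting that z attains its minimum.

open import Defs
open import Data.Nat using (ℕ)
open import Data.Product using (_×_; ∃-syntax)
open import Data.Sum using (_⊎_)
open import Relation.Binary.PropositionalEquality using (_≡_)
open import Relation.Nullary using (¬_)

import Data.Nat as ℕ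
open import Data.Bool using (Bool; true; false; not; _∧_; _∨_; if_then_else_)
open import Data.Bool.Properties using (not-involutive)
open import Data.Empty using (⊥)
open import Data.Fin using (Fin; zero; suc; _≟_)
open import Data.Integer using (ℤ; +_; -_; _-_; _≤_; _<_; _+_; _*_; 0ℤ; 1ℤ)
open import Data.Integer.Properties
  using ( ≤-antisym; ≤-trans; ≤-refl; ≤-totalOrder; +-mono-≤; +-monoʳ-≤
        ; +-identityˡ; +-identityʳ; +-assoc; *-zeroʳ; *-distribˡ-+; *-monoˡ-≤-nonNeg
        ; pos-+; pos-*; i*j≡0⇒i≡0∨j≡0; i-j≡0⇒i≡j; i≤j⇒i-j≤0; ≤∧≢⇒<; i<j⇒suc[i]≤j
        ; +-*-semiring)
open import Data.Integer.Tactic.RingSolver using (solve-∀)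
open import Data.List using (allFin)
open import Data.List.Extrema ≤-totalOrder using (argmin; f[argmin]≤f[xs])
open import Data.List.Membership.Propositional.Properties using (∈-allFin)
open import Data.List.Relation.Unary.All using (lookup)
open import Data.Product using (_,_; proj₁; proj₂)
open import Data.Sum using (inj₁; inj₂)
open import Function using (_∘_; case_of_)
open import Relation.Binary.PropositionalEquality
  using (_≢_; refl; sym; trans; cong; cong₂; subst; module ≡-Reasoning)
open import Relation.Nullary using (yes; no)
open import Relation.Nullary.Decidable using (⌊_⌋; isYes≗does)

import Algebra.Properties.Semiring.Sum +-*-semiring as Σℤ

open ≡-Reasoning

-- Finite sums of integers.  'sumℤ' agrees with the library's semiring sum,
-- whose algebraic laws we transport.

sumℤ≡sum : ∀ {n} (f : Fin n → ℤ) → sumℤ f ≡ Σℤ.sum f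
sumℤ≡sum {ℕ.zero}  f = refl
sumℤ≡sum {ℕ.suc n} f = cong (_+_ (f zero)) (sumℤ≡sum (f ∘ suc))

-- Sums of pointwise equal functions agree (there is no function extensionality).
sumℤ-cong : ∀ {n} {f g : Fin n → ℤ} → (∀ u → f u ≡ g u) → sumℤ f ≡ sumℤ g
sumℤ-cong {f = f} {g} f≗g =
  trans (sumℤ≡sum f) (trans (Σℤ.sum-cong-≗ f≗g) (sym (sumℤ≡sum g)))

sumℤ-+ : ∀ {n} (f g : Fin n → ℤ) → sumℤ (λ u → f u + g u) ≡ sumℤ f + sumℤ g
sumℤ-+ f g = begin
  sumℤ (λ u → f u + g u)    ≡⟨ sumℤ≡sum (λ u → f u + g u) ⟩
  Σℤ.sum (λ u → f u + g u)  ≡⟨ Σℤ.∑-distrib-+ f g ⟩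
  Σℤ.sum f + Σℤ.sum g       ≡⟨ sym (cong₂ _+_ (sumℤ≡sum f) (sumℤ≡sum g)) ⟩
  sumℤ f + sumℤ g           ∎

sumℤ-*ʳ : ∀ {n} (f : Fin n → ℤ) (c : ℤ) → sumℤ f * c ≡ sumℤ (λ u → f u * c)
sumℤ-*ʳ f c = begin
  sumℤ f * c                ≡⟨ cong (_* c) (sumℤ≡sum f) ⟩
  Σℤ.sum f * c              ≡⟨ Σℤ.*-distribʳ-sum c f ⟩
  Σℤ.sum (λ u → f u * c)    ≡⟨ sym (sumℤ≡sum (λ u → f u * c)) ⟩
  sumℤ (λ u → f u * c)      ∎

sumℕ-cong : ∀ {n} {f g : Fin n → ℕ} → (∀ u → f u ≡ g u) → sumℕ f ≡ sumℕ g
sumℕ-cong {ℕ.zero}  f≗g = refl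
sumℕ-cong {ℕ.suc n} f≗g = cong₂ ℕ._+_ (f≗g zero) (sumℕ-cong (f≗g ∘ suc))

sumℤ-cast : ∀ {n} (f : Fin n → ℕ) → sumℤ (λ u → + f u) ≡ + sumℕ f
sumℤ-cast {ℕ.zero}  f = refl
sumℤ-cast {ℕ.suc n} f =
  trans (cong (_+_ (+ f zero)) (sumℤ-cast (f ∘ suc))) (sym (pos-+ (f zero) _))

sumℤ-δ : ∀ {n} (v : Fin n) (a : ℤ) → sumℤ (λ u → if ⌊ v ≟ u ⌋ then a else 0ℤ) ≡ a
sumℤ-δ {ℕ.suc n} zero a = begin
  a + sumℤ (λ (_ : Fin n) → 0ℤ)  ≡⟨ cong (_+_ a) (trans (sumℤ≡sum {n} (λ _ → 0ℤ)) (Σℤ.sum-replicate-zero n)) ⟩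
  a + 0ℤ                         ≡⟨ +-identityʳ a ⟩
  a                              ∎
sumℤ-δ {ℕ.suc n} (suc v) a = begin
  0ℤ + sumℤ (λ u → if ⌊ suc v ≟ suc u ⌋ then a else 0ℤ)  ≡⟨ +-identityˡ _ ⟩
  sumℤ (λ u → if ⌊ suc v ≟ suc u ⌋ then a else 0ℤ)       ≡⟨ sumℤ-cong (cong (if_then a else 0ℤ) ∘ suc≟suc v) ⟩
  sumℤ (λ u → if ⌊ v ≟ u ⌋ then a else 0ℤ)               ≡⟨ sumℤ-δ v a ⟩
  a                                                      ∎
  where
  -- '⌊_⌋' is stuck on the decision procedure, so equality of the tests is
  -- transported through 'does'.
  suc≟suc : ∀ {n} (v u : Fin n) → ⌊ suc v ≟ suc u ⌋ ≡ ⌊ v ≟ u ⌋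
  suc≟suc v u = trans (isYes≗does (suc v ≟ suc u)) (sym (isYes≗does (v ≟ u)))

nonpos-pair : ∀ {a b : ℤ} → a ≤ 0ℤ → b ≤ 0ℤ → 0ℤ ≤ a + b → a ≡ 0ℤ × b ≡ 0ℤ
nonpos-pair {a} {b} a≤0 b≤0 0≤a+b = a≡0 , b≡0
  where
  a≡0 : a ≡ 0ℤ
  a≡0 = ≤-antisym a≤0 (≤-trans 0≤a+b (subst (a + b ≤_) (+-identityʳ a) (+-monoʳ-≤ a b≤0)))
  b≡0 : b ≡ 0ℤ
  b≡0 = ≤-antisym b≤0 (subst (0ℤ ≤_) (+-identityˡ b) (subst (λ x → 0ℤ ≤ x + b) a≡0 0≤a+b))

sumℤ-nonpos : ∀ {n} (f : Fin n → ℤ) → (∀ u → f u ≤ 0ℤ) → sumℤ f ≤ 0ℤ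
sumℤ-nonpos {ℕ.zero}  f f≤0 = ≤-refl
sumℤ-nonpos {ℕ.suc n} f f≤0 = +-mono-≤ (f≤0 zero) (sumℤ-nonpos (f ∘ suc) (f≤0 ∘ suc))

nonpos-terms-vanish : ∀ {n} (f : Fin n → ℤ) → (∀ u → f u ≤ 0ℤ) → 0ℤ ≤ sumℤ f →
  ∀ u → f u ≡ 0ℤ
nonpos-terms-vanish {ℕ.suc n} f f≤0 0≤Σf = vanish
  where
  head-and-tail : f zero ≡ 0ℤ × sumℤ (f ∘ suc) ≡ 0ℤ
  head-and-tail = nonpos-pair (f≤0 zero) (sumℤ-nonpos (f ∘ suc) (f≤0 ∘ suc)) 0≤Σf

  vanish : ∀ u → f u ≡ 0ℤ
  vanish zero    = proj₁ head-and-tail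
  vanish (suc u) = nonpos-terms-vanish (f ∘ suc) (f≤0 ∘ suc)
                     (subst (0ℤ ≤_) (sym (proj₂ head-and-tail)) ≤-refl) u

-- The Laplacian and the divisor D + L z, edge by edge.

-- One entry of L z: the diagonal contributes deg(v)·z(v), every other vertex
-- −mult(v,u)·z(u).  On the diagonal the second summand vanishes because G
-- has no loops.
laplacian-entry : ∀ {n} (G : Multigraph n) (z : Fin n → ℤ) (v u : Fin n) →
  Laplacian G v u * z u
    ≡ (if ⌊ v ≟ u ⌋ then + deg G v * z v else 0ℤ) + - (+ mult G v u * z u)
laplacian-entry G z v u with v ≟ u
... | yes refl rewrite loopless G v = sym (+-identityʳ (+ deg G v * z v))
... | no _ = off-diagonal (+ mult G v u) (z u)
  where
  off-diagonal : ∀ (k x : ℤ) → - k * x ≡ 0ℤ + - (k * x)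
  off-diagonal = solve-∀

laplacian-expansion : ∀ {n} (G : Multigraph n) (z : Fin n → ℤ) (v : Fin n) →
  applyL G z v ≡ sumℤ (λ u → + mult G v u * (z v - z u))
laplacian-expansion G z v = begin
  applyL G z v
    ≡⟨ sumℤ-cong (laplacian-entry G z v) ⟩
  sumℤ (λ u → diagonal u + - (+ mult G v u * z u))
    ≡⟨ sumℤ-+ diagonal (λ u → - (+ mult G v u * z u)) ⟩
  sumℤ diagonal + sumℤ (λ u → - (+ mult G v u * z u))
    ≡⟨ cong (_+ sumℤ (λ u → - (+ mult G v u * z u))) degree-term ⟩
  sumℤ (λ u → + mult G v u * z v) + sumℤ (λ u → - (+ mult G v u * z u))
    ≡⟨ sym (sumℤ-+ (λ u → + mult G v u * z v) (λ u → - (+ mult G v u * z u))) ⟩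
  sumℤ (λ u → + mult G v u * z v + - (+ mult G v u * z u))
    ≡⟨ sumℤ-cong (λ u → factor (+ mult G v u) (z v) (z u)) ⟩
  sumℤ (λ u → + mult G v u * (z v - z u))
    ∎
  where
  diagonal : Fin _ → ℤ
  diagonal u = if ⌊ v ≟ u ⌋ then + deg G v * z v else 0ℤ

  degree-term : sumℤ diagonal ≡ sumℤ (λ u → + mult G v u * z v)
  degree-term = begin
    sumℤ diagonal                         ≡⟨ sumℤ-δ v (+ deg G v * z v) ⟩
    + deg G v * z v                       ≡⟨ cong (_* z v) (sym (sumℤ-cast (mult G v))) ⟩
    sumℤ (λ u → + mult G v u) * z v       ≡⟨ sumℤ-*ʳ (λ u → + mult G v u) (z v) ⟩
    sumℤ (λ u → + mult G v u * z v)       ∎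

  factor : ∀ (k a b : ℤ) → k * a + - (k * b) ≡ k * (a - b)
  factor = solve-∀

leaves : ∀ {n} → Subset n → Fin n → Fin n → Bool
leaves X v u = X v ∧ not (X u)

-- The contribution of the edge vu to (D + L z)(v), per unit of multiplicity.
slope : ∀ {n} → Subset n → (Fin n → ℤ) → Fin n → Fin n → ℤ
slope X z v u = (if leaves X v u then 1ℤ else 0ℤ) + (z v - z u)

edgeTerm : ∀ {n} → Multigraph n → Subset n → (Fin n → ℤ) → Fin n → Fin n → ℤ
edgeTerm G X z v u = + mult G v u * slope X z v u

boundary-edgewise : ∀ {n} (G : Multigraph n) (X : Subset n) (v : Fin n) →
  + (degAB G X v ℕ.* χ X v)
    ≡ sumℤ (λ u → + mult G v u * (if leaves X v u then 1ℤ else 0ℤ))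
boundary-edgewise G X v = begin
  + (degAB G X v ℕ.* χ X v)                             ≡⟨ pos-* (degAB G X v) (χ X v) ⟩
  + degAB G X v * + χ X v                               ≡⟨ cong (_* + χ X v) (sym (sumℤ-cast crossing)) ⟩
  sumℤ (λ u → + crossing u) * + χ X v                   ≡⟨ sumℤ-*ʳ (λ u → + crossing u) (+ χ X v) ⟩
  sumℤ (λ u → + crossing u * + χ X v)                   ≡⟨ sumℤ-cong (λ u → crossing-term (X v) (X u) (mult G v u)) ⟩
  sumℤ (λ u → + mult G v u * (if leaves X v u then 1ℤ else 0ℤ)) ∎
  where
  crossing : Fin _ → ℕ
  crossing u = if crosses X v u then mult G v u else 0

  -- An edge counted by deg_AB at v ∈ X is exactly an edge leaving X.
  crossing-term : ∀ a b k →
    + (if (a ∧ not b) ∨ (not a ∧ b) then k else 0) * + (if a then 1 else 0)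
      ≡ + k * (if a ∧ not b then 1ℤ else 0ℤ)
  crossing-term true  true  k = sym (*-zeroʳ (+ k))
  crossing-term true  false k = refl
  crossing-term false true  k = refl
  crossing-term false false k = sym (*-zeroʳ (+ k))

boundary-plus-laplacian : ∀ {n} (G : Multigraph n) (X : Subset n) (z : Fin n → ℤ) (v : Fin n) →
  + (degAB G X v ℕ.* χ X v) + applyL G z v ≡ sumℤ (edgeTerm G X z v)
boundary-plus-laplacian G X z v = begin
  + (degAB G X v ℕ.* χ X v) + applyL G z v
    ≡⟨ cong₂ _+_ (boundary-edgewise G X v) (laplacian-expansion G z v) ⟩
  sumℤ (λ u → + mult G v u * exit u) + sumℤ (λ u → + mult G v u * (z v - z u))
    ≡⟨ sym (sumℤ-+ (λ u → + mult G v u * exit u) (λ u → + mult G v u * (z v - z u))) ⟩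
  sumℤ (λ u → + mult G v u * exit u + + mult G v u * (z v - z u))
    ≡⟨ sumℤ-cong (λ u → sym (*-distribˡ-+ (+ mult G v u) (exit u) (z v - z u))) ⟩
  sumℤ (edgeTerm G X z v)
    ∎
  where
  exit : Fin _ → ℤ
  exit u = if leaves X v u then 1ℤ else 0ℤ

-- Paths inside an induced subgraph.

Reach-source : ∀ {n} {G : Multigraph n} {S : Subset n} {u v} → Reach G S u v → S u ≡ true
Reach-source (here Su)     = Su
Reach-source (step Su _ _) = Su

Reach-transport : ∀ {n} {G : Multigraph n} {S : Subset n} (P : Fin n → Set) →
  (∀ {v u} → S v ≡ true → S u ≡ true → 0 ℕ.< mult G v u → P v → P u) →
  ∀ {u w} → Reach G S u w → P u → P w
Reach-transport P spread (here _)          Pu = Pu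
Reach-transport P spread (step Su edge path) Pu =
  Reach-transport P spread path (spread Su (Reach-source path) edge Pu)

Reach-mono : ∀ {n} {G : Multigraph n} {S S′ : Subset n} →
  (∀ w → S w ≡ true → S′ w ≡ true) → ∀ {u v} → Reach G S u v → Reach G S′ u v
Reach-mono S⊆S′ (here Su)           = here (S⊆S′ _ Su)
Reach-mono S⊆S′ (step Su edge path) = step (S⊆S′ _ Su) edge (Reach-mono S⊆S′ path)

InducesConnected-resp : ∀ {n} {G : Multigraph n} {S S′ : Subset n} →
  (∀ w → S w ≡ S′ w) → InducesConnected G S → InducesConnected G S′
InducesConnected-resp S≗S′ connected u v S′u S′v =
  Reach-mono (λ w Sw → trans (sym (S≗S′ w)) Sw)
    (connected u v (trans (S≗S′ u) S′u) (trans (S≗S′ v) S′v))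

SuppMeets-resp : ∀ {n} {D : Divisor n} {S S′ : Subset n} →
  (∀ w → S w ≡ S′ w) → SuppMeets D S → SuppMeets D S′
SuppMeets-resp S≗S′ (w , Sw , Dw≢0) = w , trans (sym (S≗S′ w)) Sw , Dw≢0

-- The cut {A, B} is unordered: every property of subsets stable under
-- pointwise equality that holds for A and for its complement holds for
-- either side X and its complement.
both-sides : ∀ {n} (P : Subset n → Set) →
  (∀ {S S′} → (∀ w → S w ≡ S′ w) → P S → P S′) →
  ∀ {A X} → X ≡ A ⊎ X ≡ compl A → P A → P (compl A) → P X × P (compl X)
both-sides P resp (inj₁ refl) PA PB = PA , PB
both-sides P resp {A} (inj₂ refl) PA PB = PB , resp (λ w → sym (not-involutive (A w))) PA

degAB-side : ∀ {n} (G : Multigraph n) {A X : Subset n} → X ≡ A ⊎ X ≡ compl A →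
  ∀ v → degAB G X v ≡ degAB G A v
degAB-side G (inj₁ refl) v = refl
degAB-side G {A} (inj₂ refl) v =
  sumℕ-cong (λ u → cong (if_then mult G v u else 0) (crosses-compl (A v) (A u)))
  where
  crosses-compl : ∀ a b →
    (not a ∧ not (not b)) ∨ (not (not a) ∧ not b) ≡ (a ∧ not b) ∨ (not a ∧ b)
  crosses-compl true  true  = refl
  crosses-compl true  false = refl
  crosses-compl false true  = refl
  crosses-compl false false = refl

slope-at-minimum : ∀ b {m zv zu : ℤ} → zv ≡ m → m ≤ zu → (b ≡ true → zu ≢ m) →
  (if b then 1ℤ else 0ℤ) + (zv - zu) ≤ 0ℤ
slope-at-minimum false {m} {zu = zu} refl m≤zu steep =
  subst (_≤ 0ℤ) (sym (+-identityˡ (m - zu))) (i≤j⇒i-j≤0 m≤zu)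
slope-at-minimum true {m} {zu = zu} refl m≤zu steep =
  subst (_≤ 0ℤ) (+-assoc 1ℤ m (- zu)) (i≤j⇒i-j≤0 (i<j⇒suc[i]≤j m<zu))
  where
  m<zu : m < zu
  m<zu = ≤∧≢⇒< m≤zu (λ m≡zu → steep refl (sym m≡zu))

level-slope : ∀ b {zv zu : ℤ} → b ≡ false → (if b then 1ℤ else 0ℤ) + (zv - zu) ≡ 0ℤ → zu ≡ zv
level-slope false {zv} {zu} refl slope≡0 = sym (i-j≡0⇒i≡j zv zu (trans (sym (+-identityˡ (zv - zu))) slope≡0))

-- A term with positive multiplicity vanishes only if its factor does (the
-- alternative + (1 + k) ≡ 0 is refuted by the coverage checker).
cancel-multiplicity : ∀ k {x : ℤ} → 0 ℕ.< k → + k * x ≡ 0ℤ → x ≡ 0ℤ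
cancel-multiplicity (ℕ.suc k) _ kx≡0 with i*j≡0⇒i≡0∨j≡0 (+ ℕ.suc k) kx≡0
... | inj₂ x≡0 = x≡0

leaves-target : ∀ a b → a ∧ not b ≡ true → b ≡ false
leaves-target true false _ = refl

leaves-outside : ∀ a b → not a ≡ true → a ∧ not b ≡ false
leaves-outside false b _ = refl

leaves-inside : ∀ a b → b ≡ true → a ∧ not b ≡ false
leaves-inside true  true _ = refl
leaves-inside false true _ = refl

minimum-exists : ∀ {n} → Fin n → (z : Fin n → ℤ) → ∃[ v ] (∀ u → z v ≤ z u)
minimum-exists {n} v₀ z =
  argmin z v₀ (allFin n) , λ u → lookup (f[argmin]≤f[xs] v₀ (allFin n)) (∈-allFin u)

module MinimumPrinciple {n} (G : Multigraph n) (X : Subset n) (z : Fin n → ℤ)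
  (D₀ : Divisor n) (effective : Effective D₀)
  (edgewise : ∀ v → D₀ v ≡ sumℤ (edgeTerm G X z v))
  (m : ℤ) (m≤z : ∀ u → m ≤ z u) where

  Flat : Fin n → Set
  Flat v = z v ≡ m

  -- At a flat vertex none of whose leaving edges ends at a flat vertex, all
  -- edge terms are ≤ 0 while their sum D₀(v) is ≥ 0; hence D₀(v) = 0 and
  -- every neighbour reached without leaving X is flat as well.
  flat-vertex : ∀ v → Flat v → (∀ u → leaves X v u ≡ true → ¬ Flat u) →
    D₀ v ≡ 0ℤ × (∀ u → leaves X v u ≡ false → 0 ℕ.< mult G v u → Flat u)
  flat-vertex v flat-v steep = D₀v≡0 , neighbour-flat
    where
    terms≤0 : ∀ u → edgeTerm G X z v u ≤ 0ℤ
    terms≤0 u = subst (edgeTerm G X z v u ≤_) (*-zeroʳ (+ mult G v u))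
      (*-monoˡ-≤-nonNeg (+ mult G v u)
        (slope-at-minimum (leaves X v u) flat-v (m≤z u) (steep u)))

    0≤sum : 0ℤ ≤ sumℤ (edgeTerm G X z v)
    0≤sum = subst (0ℤ ≤_) (edgewise v) (effective v)

    D₀v≡0 : D₀ v ≡ 0ℤ
    D₀v≡0 = trans (edgewise v) (≤-antisym (sumℤ-nonpos _ terms≤0) 0≤sum)

    neighbour-flat : ∀ u → leaves X v u ≡ false → 0 ℕ.< mult G v u → Flat u
    neighbour-flat u stays edge = trans (level-slope (leaves X v u) stays slope≡0) flat-v
      where
      slope≡0 : slope X z v u ≡ 0ℤ
      slope≡0 = cancel-multiplicity (mult G v u) edge (nonpos-terms-vanish _ terms≤0 0≤sum u)

  -- Flatness of one vertex
  -- of S would spread through S to its support vertex, where D₀ ≠ 0; so no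
  -- vertex of S is flat.
  side-not-flat : (S : Subset n) → InducesConnected G S → SuppMeets D₀ S →
    (∀ {v u} → S v ≡ true → S u ≡ true → leaves X v u ≡ false) →
    (∀ {v} → S v ≡ true → ∀ u → leaves X v u ≡ true → ¬ Flat u) →
    ∀ v → S v ≡ true → ¬ Flat v
  side-not-flat S connected (w , Sw , D₀w≢0) inside steep v Sv flat-v =
    D₀w≢0 (proj₁ (flat-vertex w flat-w (steep Sw)))
    where
    spread : ∀ {v u} → S v ≡ true → S u ≡ true → 0 ℕ.< mult G v u → Flat v → Flat u
    spread Sv Su edge flat = proj₂ (flat-vertex _ flat (steep Sv)) _ (inside Sv Su) edge

    flat-w : Flat w
    flat-w = Reach-transport Flat spread (connected v w Sv Sw) flat-v

  -- No edge leaves X from its complement, so its vertices are not flat.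
  outside-not-flat : InducesConnected G (compl X) → SuppMeets D₀ (compl X) →
    ∀ v → X v ≡ false → ¬ Flat v
  outside-not-flat connected meets v Xv≡false =
    side-not-flat (compl X) connected meets
      (λ {v} {u} Sv _ → leaves-outside (X v) (X u) Sv)
      (λ {v} Sv u leaving → case trans (sym leaving) (leaves-outside (X v) (X u) Sv) of λ ())
      v (cong not Xv≡false)

  -- Edges leaving X end outside X, where nothing is flat; so X has no flat
  -- vertex either.
  inside-not-flat : InducesConnected G X → SuppMeets D₀ X →
    (∀ u → X u ≡ false → ¬ Flat u) → ∀ v → X v ≡ true → ¬ Flat v
  inside-not-flat connected meets outside =
    side-not-flat X connected meets
      (λ {v} {u} _ Xu → leaves-inside (X v) (X u) Xu)
      (λ {v} _ u leaving → outside u (leaves-target (X v) (X u) leaving))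

  no-flat-vertex : InducesConnected G X → InducesConnected G (compl X) →
    SuppMeets D₀ X → SuppMeets D₀ (compl X) → ∀ v → ¬ Flat v
  no-flat-vertex X-connected Y-connected meets-X meets-Y v with X v in Xv
  ... | true  = inside-not-flat X-connected meets-X outside v Xv
    where
    outside : ∀ u → X u ≡ false → ¬ Flat u
    outside = outside-not-flat Y-connected meets-Y
  ... | false = outside-not-flat Y-connected meets-Y v Xv

-- The core statement, with X the side carrying the boundary divisor: an
-- effective D₀ = D + L z cannot meet both sides, because z would then have no
-- flat vertex at its minimum.
no-effective-across : ∀ {n} (G : Multigraph n) (X : Subset n) (z : Fin n → ℤ) (D₀ : Divisor n) →
  InducesConnected G X → InducesConnected G (compl X) → Effective D₀ →
  (∀ v → D₀ v ≡ sumℤ (edgeTerm G X z v)) →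
  SuppMeets D₀ X → SuppMeets D₀ (compl X) → ⊥
no-effective-across G X z D₀ X-connected Y-connected effective edgewise meets-X meets-Y
  with minimum-exists (proj₁ meets-X) z
... | vmin , minimal =
  no-flat-vertex X-connected Y-connected meets-X meets-Y vmin refl
  where open MinimumPrinciple G X z D₀ effective edgewise (z vmin) minimal

linearly-equivalent-edgewise : ∀ {n} (G : Multigraph n) {A X : Subset n} →
  X ≡ A ⊎ X ≡ compl A → ∀ {D D₀ : Divisor n} → IsBoundaryDivisor G A X D →
  ∀ {z} → (∀ v → D₀ v - D v ≡ applyL G z v) → ∀ v → D₀ v ≡ sumℤ (edgeTerm G X z v)
linearly-equivalent-edgewise G {A} {X} side {D} {D₀} boundary {z} D₀-D≡Lz v = begin
  D₀ v                                      ≡⟨ shift (D₀ v) (D v) ⟩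
  D v + (D₀ v - D v)                        ≡⟨ cong₂ _+_ (boundary v) (D₀-D≡Lz v) ⟩
  + (degAB G A v ℕ.* χ X v) + applyL G z v  ≡⟨ cong (λ d → + (d ℕ.* χ X v) + applyL G z v) (sym (degAB-side G side v)) ⟩
  + (degAB G X v ℕ.* χ X v) + applyL G z v  ≡⟨ boundary-plus-laplacian G X z v ⟩
  sumℤ (edgeTerm G X z v)                   ∎
  where
  shift : ∀ (a b : ℤ) → a ≡ b + (a - b)
  shift = solve-∀

lemma2p1 : (n : ℕ) (G : Multigraph n) → Connected G →
    (A : Subset n) → IsCut G A →
    (X : Subset n) → (X ≡ A ⊎ X ≡ compl A) →
    (D : Divisor n) → IsBoundaryDivisor G A X D →
    ¬ (∃[ D₀ ] (Effective D₀ × LinEquiv G D₀ D × SuppMeets D₀ A × SuppMeets D₀ (compl A)))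
lemma2p1 n G _ A (_ , _ , A-connected , B-connected) X side D boundary
         (D₀ , effective , (z , D₀-D≡Lz) , meets-A , meets-B) =
  let X-connected , Y-connected =
        both-sides (InducesConnected G) InducesConnected-resp side A-connected B-connected
      meets-X , meets-Y = both-sides (SuppMeets D₀) SuppMeets-resp side meets-A meets-B
  in no-effective-across G X z D₀ X-connected Y-connected effective
       (linearly-equivalent-edgewise G side boundary D₀-D≡Lz) meets-X meets-Y
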